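{- Let $(b_n)_{n\ge0}$ be the Baum--Sweet sequence over $\mathbb{F}_2$: $b_0=1$ and, for $n\ge1$, $b_n=1$ if the binary representation of $n$ contains no block of consecutive $0$'s of odd length, and $b_n=0$ otherwise. Then for every $N\ge1$, $$\frac{N}{3}\le L(b_n,N)\le\frac{2N+1}{3}.$$
   Context: The $N$th linear complexity $L(u_n,N)$ of a sequence $(u_n)$ over $\mathbb{F}_2$ is the least $L\ge 0$ such that there exist $c_0,\dots,c_{L-1}\in\mathbb{F}_2$ with $u_{n+L}=c_{L-1}u_{n+L-1}+\dots+c_0u_n$ for all $0\le n\le N-L-1$; by convention $L(u_n,N)=0$ if $u_0=\dots=u_{N-1}=0$, and $L(u_n,N)=N$ if $u_0=\dots=u_{N-2}=0\ne u_{N-1}$. -}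

module Defs where

open import Data.Bool using (Bool; true; false; _∧_; _xor_; if_then_else_; not)
open import Data.Nat using (ℕ; zero; suc; _+_; _<_; _%_; _/_; _≡ᵇ_)
open import Data.Fin using (Fin; toℕ)
import Data.Fin as Fin
open import Data.List using (List; []; _∷_)
open import Data.Bool.ListAction using (any)
open import Relation.Binary.PropositionalEquality using (_≡_)
open import Relation.Nullary using (¬_)
open import Data.Product using (Σ)

-- Elements of 𝔽₂ are represented by Bool (xor = addition, ∧ = multiplication).

-- Binary digits of m, least significant first, no leading zeros
-- (bitsAux fuel m; fuel ≥ number of digits suffices, e.g. fuel = m).
bitsAux : ℕ → ℕ → List Bool
bitsAux zero    _       = []
bitsAux (suc k) zero    = []
bitsAux (suc k) (suc m) = ((suc m % 2) ≡ᵇ 1) ∷ bitsAux k (suc m / 2)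

binary : ℕ → List Bool
binary n = bitsAux n n

-- Lengths of the maximal blocks of consecutive 0's (false) in a digit list;
-- the second argument is the length of the currently open block.
zeroBlocks : List Bool → ℕ → List ℕ
zeroBlocks []           zero    = []
zeroBlocks []           (suc c) = suc c ∷ []
zeroBlocks (false ∷ xs) c       = zeroBlocks xs (suc c)
zeroBlocks (true ∷ xs)  zero    = zeroBlocks xs zero
zeroBlocks (true ∷ xs)  (suc c) = suc c ∷ zeroBlocks xs zero

isOdd : ℕ → Bool
isOdd k = (k % 2) ≡ᵇ 1

baumSweet : ℕ → Bool
baumSweet zero    = true
baumSweet (suc n) = not (any isOdd (zeroBlocks (binary (suc n)) zero))

linComb : (L : ℕ) → (Fin L → Bool) → (ℕ → Bool) → ℕ → Bool
linComb zero    c u n = false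
linComb (suc L) c u n = (c Fin.zero ∧ u n) xor linComb L (λ i → c (Fin.suc i)) (λ k → u (suc k)) n

HasRecurrence : (ℕ → Bool) → ℕ → ℕ → Set
HasRecurrence u N L =
  Σ (Fin L → Bool) λ c → ∀ n → n + L < N → u (n + L) ≡ linComb L c u n

-- L is the N-th linear complexity of u: the least L with such a recurrence.
-- (The stated conventions for the all-zero / u₀=…=u_{N-2}=0≠u_{N-1} cases
-- agree with this definition.)
IsLinearComplexity : (ℕ → Bool) → ℕ → ℕ → Set
IsLinearComplexity u N L = HasRecurrence u N L × (∀ L′ → L′ < L → ¬ HasRecurrence u N L′)
  where open import Data.Product using (_×_)

module Submission where

-- Let G = Σ_{n<N} bₙ Xⁿ ∈ 𝔽₂[X].  The recursions b₂ₙ₊₁ = bₙ, b₄ₙ = bₙ,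
-- b₄ₙ₊₂ = 0 give the functional equation G⁴ + X G² + G ≡ 0 (mod X^N).  A recurrence
-- of length L ≥ 1 has a characteristic polynomial F with F(0) = 1 and deg F ≤ L, and
-- F·G agrees mod X^N with its truncation g of degree < L.  Multiplying the functional
-- equation by F⁴ gives g·Q(F,g) ≡ 0 with Q(F,g) = g³ + X F² g + F³; as g(0) = 1,
-- Q(F,g) ≡ 0 (mod X^N), and deg Q(F,g) ≤ 3L, so 3L < N would force Q(F,g) = 0.  That
-- is impossible when F(0) = 1: evaluating at X = 1 shows that 1+X divides F and g,
-- and Q is homogeneous of degree 3, so the quotients are a smaller root (descent).
--
-- A Berlekamp–Massey style construction keeps a shortest recurrence
-- for the first N terms together with the last recurrence that broke down; when the
-- current one breaks at N, a combination of the two of length max(L, N+1-L′) takes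
-- over.  Together with the lower bound this maintains 3L ≤ 2N+1.

open import Defs
open import Data.Bool using (Bool; true; false; _∧_; _xor_; not)
open import Data.Bool.Properties
  using (xor-∧-commutativeRing; xor-same; xor-comm; xor-assoc; xor-identityʳ;
         ∧-zeroʳ; ∧-identityʳ; ∧-comm; ¬-not)
import Data.Bool.Properties as Bool
open import Data.Bool.ListAction using (any)
open import Data.Nat
  using (ℕ; zero; suc; _+_; _*_; _≤_; _<_; _⊔_; z≤n; s≤s; _≤?_; _<?_; _≡ᵇ_)
open import Data.Nat.Properties
open import Data.Nat.DivMod using (_%_; _/_; m/n<m; m/n≡1+[m∸n]/n)
open import Data.Nat.Tactic.RingSolver using (solve-∀)
open import Data.List using (List; []; _∷_; length; _++_; take; replicate; tabulate; lookup)
open import Data.List.Properties using (length-++; length-replicate; length-tabulate; tabulate-lookup)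
import Data.Fin as Fin
open import Data.Maybe using (nothing)
open import Data.Product using (_,_; proj₁; proj₂; _×_)
open import Data.Sum using (_⊎_; inj₁; inj₂)
open import Data.Empty using (⊥-elim)
open import Relation.Nullary using (¬_; Dec; yes; no)
open import Relation.Binary.PropositionalEquality
open import Level using (0ℓ)
open import Algebra.Bundles using (CommutativeRing)
import Tactic.RingSolver.Core.AlmostCommutativeRing as ACR
import Tactic.RingSolver as RingSolver

𝔽₂ : ACR.AlmostCommutativeRing 0ℓ 0ℓ
𝔽₂ = ACR.fromCommutativeRing xor-∧-commutativeRing (λ _ → nothing)

-- Cancellation in characteristic 2 (not a ring identity, so not in reach of the solver).
xor-cancelˡ : ∀ x y → x xor (x xor y) ≡ y
xor-cancelˡ x y = trans (sym (xor-assoc x x y)) (cong (_xor y) (xor-same x))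

xor≡false⇒≡ : ∀ x y → x xor y ≡ false → x ≡ y
xor≡false⇒≡ true  true  _ = refl
xor≡false⇒≡ false false _ = refl

-- Doubling by structural recursion, so that residues mod 2 and mod 4 are patterns.
double : ℕ → ℕ
double zero    = zero
double (suc n) = suc (suc (double n))

n≤double : ∀ n → n ≤ double n
n≤double zero    = z≤n
n≤double (suc n) = s≤s (m≤n⇒m≤1+n (n≤double n))

halve-suc-suc : ∀ m → suc (suc m) / 2 ≡ suc (m / 2)
halve-suc-suc m = m/n≡1+[m∸n]/n {suc (suc m)} {2} (s≤s (s≤s z≤n))

halve-double : ∀ i → double i / 2 ≡ i
halve-double zero    = refl
halve-double (suc i) = trans (halve-suc-suc (double i)) (cong suc (halve-double i))

halve-suc-double : ∀ i → suc (double i) / 2 ≡ i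
halve-suc-double zero    = refl
halve-suc-double (suc i) = trans (halve-suc-suc (suc (double i))) (cong suc (halve-suc-double i))

-- The lowest bit of 2i and 2i+1 (suc (suc m) % 2 reduces to m % 2).
double%2 : ∀ i → double i % 2 ≡ 0
double%2 zero    = refl
double%2 (suc i) = double%2 i

suc-double%2 : ∀ i → suc (double i) % 2 ≡ 1
suc-double%2 zero    = refl
suc-double%2 (suc i) = suc-double%2 i

bitsAux-fuel : ∀ k k′ m → m ≤ k → m ≤ k′ → bitsAux k m ≡ bitsAux k′ m
bitsAux-fuel zero    zero     zero    _       _        = refl
bitsAux-fuel zero    (suc k′) zero    _       _        = refl
bitsAux-fuel (suc k) zero     zero    _       _        = refl
bitsAux-fuel (suc k) (suc k′) zero    _       _        = refl
bitsAux-fuel (suc k) (suc k′) (suc m) (s≤s h) (s≤s h′) =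
  cong (_ ∷_) (bitsAux-fuel k k′ (suc m / 2) (halve≤ h) (halve≤ h′))
  where
  halve≤ : ∀ {x} → m ≤ x → suc m / 2 ≤ x
  halve≤ = ≤-trans (<⇒≤pred (m/n<m (suc m) 2 (s≤s (s≤s z≤n))))

binary-suc-double : ∀ i → binary (suc (double i)) ≡ true ∷ binary i
binary-suc-double i = cong₂ _∷_ (cong (_≡ᵇ 1) (suc-double%2 i))
  (trans (cong (bitsAux (double i)) (halve-suc-double i))
         (bitsAux-fuel (double i) i i (n≤double i) ≤-refl))

binary-double : ∀ j → binary (double (suc j)) ≡ false ∷ binary (suc j)
binary-double j = cong₂ _∷_ (cong (_≡ᵇ 1) (double%2 j))
  (trans (cong (bitsAux (suc (double j))) (halve-double (suc j)))
         (bitsAux-fuel (suc (double j)) (suc j) (suc j) (s≤s (n≤double j)) ≤-refl))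

oddBlock-+2 : ∀ xs c → any isOdd (zeroBlocks xs (suc (suc c))) ≡ any isOdd (zeroBlocks xs c)
oddBlock-+2 []           zero    = refl
oddBlock-+2 []           (suc c) = refl
oddBlock-+2 (false ∷ xs) c       = oddBlock-+2 xs (suc c)
oddBlock-+2 (true ∷ xs)  zero    = refl
oddBlock-+2 (true ∷ xs)  (suc c) = refl

baumSweet-odd : ∀ i → baumSweet (suc (double i)) ≡ baumSweet i
baumSweet-odd zero    = refl
baumSweet-odd (suc i) = cong (λ l → not (any isOdd (zeroBlocks l zero))) (binary-suc-double (suc i))

baumSweet-4n : ∀ q → baumSweet (double (double q)) ≡ baumSweet q
baumSweet-4n zero    = refl
baumSweet-4n (suc q) =
  trans (cong (λ l → not (any isOdd (zeroBlocks l zero)))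
              (trans (binary-double (suc (double q))) (cong (false ∷_) (binary-double q))))
        (cong not (oddBlock-+2 (binary (suc q)) zero))

baumSweet-4n+2 : ∀ q → baumSweet (double (suc (double q))) ≡ false
baumSweet-4n+2 q = cong (λ l → not (any isOdd (zeroBlocks l zero)))
  (trans (binary-double (double q)) (cong (false ∷_) (binary-suc-double q)))

-- Polynomials over 𝔽₂ as coefficient lists, lowest degree first.  Trailing zeros are
-- allowed, so equality of polynomials is coefficientwise equality _≈_.
Poly : Set
Poly = List Bool

coef : Poly → ℕ → Bool
coef []      k       = false
coef (a ∷ p) zero    = a
coef (a ∷ p) (suc k) = coef p k

infix 4 _≈_
record _≈_ (p q : Poly) : Set where
  constructor coefwise
  field coef-≈ : ∀ k → coef p k ≡ coef q k
open _≈_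

≈-refl : ∀ {p} → p ≈ p
≈-refl = coefwise λ _ → refl

≈-sym : ∀ {p q} → p ≈ q → q ≈ p
≈-sym h = coefwise λ k → sym (coef-≈ h k)

≈-trans : ∀ {p q r} → p ≈ q → q ≈ r → p ≈ r
≈-trans h h′ = coefwise λ k → trans (coef-≈ h k) (coef-≈ h′ k)

∷-cong : ∀ {a b p q} → a ≡ b → p ≈ q → a ∷ p ≈ b ∷ q
∷-cong a≡b h = coefwise λ { zero → a≡b ; (suc k) → coef-≈ h k }

∷-tail : ∀ {a b p q} → a ∷ p ≈ b ∷ q → p ≈ q
∷-tail h = coefwise λ k → coef-≈ h (suc k)

∷-tail-zero : ∀ {a p} → a ∷ p ≈ [] → p ≈ []
∷-tail-zero h = coefwise λ k → coef-≈ h (suc k)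

infixl 6 _⊕_
_⊕_ : Poly → Poly → Poly
[]      ⊕ q       = q
(a ∷ p) ⊕ []      = a ∷ p
(a ∷ p) ⊕ (b ∷ q) = (a xor b) ∷ (p ⊕ q)

coef-⊕ : ∀ p q k → coef (p ⊕ q) k ≡ coef p k xor coef q k
coef-⊕ []      q       k       = refl
coef-⊕ (a ∷ p) []      k       = sym (xor-identityʳ _)
coef-⊕ (a ∷ p) (b ∷ q) zero    = refl
coef-⊕ (a ∷ p) (b ∷ q) (suc k) = coef-⊕ p q k

scale : Bool → Poly → Poly
scale a []      = []
scale a (b ∷ p) = (a ∧ b) ∷ scale a p

coef-scale : ∀ a p k → coef (scale a p) k ≡ a ∧ coef p k
coef-scale a []      k       = sym (∧-zeroʳ a)
coef-scale a (b ∷ p) zero    = refl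
coef-scale a (b ∷ p) (suc k) = coef-scale a p k

infixl 7 _⊗_
_⊗_ : Poly → Poly → Poly
[]      ⊗ q = []
(a ∷ p) ⊗ q = scale a q ⊕ (false ∷ p ⊗ q)

-- The coefficients of a product; (a ∷ p) ⊗ q unfolds to the left-hand side with r = p ⊗ q.
coef-⊗ : ∀ a q r k → coef (scale a q ⊕ (false ∷ r)) k ≡ (a ∧ coef q k) xor coef (false ∷ r) k
coef-⊗ a q r k = trans (coef-⊕ (scale a q) _ k) (cong (_xor _) (coef-scale a q k))

⊕-cong : ∀ {p p′ q q′} → p ≈ p′ → q ≈ q′ → p ⊕ q ≈ p′ ⊕ q′
⊕-cong {p} {p′} {q} {q′} h h′ = coefwise λ k →
  trans (coef-⊕ p q k) (trans (cong₂ _xor_ (coef-≈ h k) (coef-≈ h′ k)) (sym (coef-⊕ p′ q′ k)))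

⊕-comm : ∀ p q → p ⊕ q ≈ q ⊕ p
⊕-comm p q = coefwise λ k →
  trans (coef-⊕ p q k) (trans (xor-comm (coef p k) (coef q k)) (sym (coef-⊕ q p k)))

⊕-assoc : ∀ p q r → p ⊕ q ⊕ r ≈ p ⊕ (q ⊕ r)
⊕-assoc p q r = coefwise λ k → begin
  coef (p ⊕ q ⊕ r) k                   ≡⟨ coef-⊕ (p ⊕ q) r k ⟩
  coef (p ⊕ q) k xor coef r k          ≡⟨ cong (_xor coef r k) (coef-⊕ p q k) ⟩
  (coef p k xor coef q k) xor coef r k ≡⟨ xor-assoc (coef p k) (coef q k) (coef r k) ⟩
  coef p k xor (coef q k xor coef r k) ≡⟨ cong (coef p k xor_) (coef-⊕ q r k) ⟨
  coef p k xor coef (q ⊕ r) k          ≡⟨ coef-⊕ p (q ⊕ r) k ⟨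
  coef (p ⊕ (q ⊕ r)) k                 ∎
  where open ≡-Reasoning

⊕-identityʳ : ∀ p → p ⊕ [] ≈ p
⊕-identityʳ p = coefwise λ k → trans (coef-⊕ p [] k) (xor-identityʳ _)

⊕-self : ∀ p → p ⊕ p ≈ []
⊕-self p = coefwise λ k → trans (coef-⊕ p p k) (xor-same (coef p k))

⊕-swap : ∀ p q r → p ⊕ (q ⊕ r) ≈ q ⊕ (p ⊕ r)
⊕-swap p q r =
  ≈-trans (≈-sym (⊕-assoc p q r)) (≈-trans (⊕-cong (⊕-comm p q) (≈-refl {r})) (⊕-assoc q p r))

⊕-interchange : ∀ p q r s → (p ⊕ q) ⊕ (r ⊕ s) ≈ (p ⊕ r) ⊕ (q ⊕ s)
⊕-interchange p q r s =
  ≈-trans (⊕-assoc p q (r ⊕ s))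
  (≈-trans (⊕-cong (≈-refl {p}) (⊕-swap q r s)) (≈-sym (⊕-assoc p r (q ⊕ s))))

false∷-zero : ∀ {p} → p ≈ [] → false ∷ p ≈ []
false∷-zero h = coefwise λ { zero → refl ; (suc k) → coef-≈ h k }

scale-false : ∀ p → scale false p ≈ []
scale-false p = coefwise (coef-scale false p)

scale-true : ∀ p → scale true p ≈ p
scale-true p = coefwise (coef-scale true p)

scale-xor : ∀ a b p → scale (a xor b) p ≈ scale a p ⊕ scale b p
scale-xor a b p = coefwise λ k → trans (coef-scale (a xor b) p k)
  (trans (Bool.∧-distribʳ-xor (coef p k) a b)
         (sym (trans (coef-⊕ (scale a p) (scale b p) k) (cong₂ _xor_ (coef-scale a p k) (coef-scale b p k)))))

scale-∧ : ∀ a b p → scale (a ∧ b) p ≈ scale a (scale b p)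
scale-∧ a b p = coefwise λ k → trans (coef-scale (a ∧ b) p k)
  (trans (Bool.∧-assoc a b (coef p k))
         (sym (trans (coef-scale a (scale b p) k) (cong (a ∧_) (coef-scale b p k)))))

scale-⊕ : ∀ a p q → scale a (p ⊕ q) ≈ scale a p ⊕ scale a q
scale-⊕ a p q = coefwise λ k → trans (coef-scale a (p ⊕ q) k)
  (trans (cong (a ∧_) (coef-⊕ p q k))
  (trans (Bool.∧-distribˡ-xor a (coef p k) (coef q k))
         (sym (trans (coef-⊕ (scale a p) (scale a q) k) (cong₂ _xor_ (coef-scale a p k) (coef-scale a q k))))))

shift-⊗ : ∀ p q → (false ∷ p) ⊗ q ≈ false ∷ p ⊗ q
shift-⊗ p q = ⊕-cong (scale-false q) (≈-refl {false ∷ p ⊗ q})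

⊗-zeroˡ : ∀ p q → p ≈ [] → p ⊗ q ≈ []
⊗-zeroˡ []      q h = ≈-refl
⊗-zeroˡ (a ∷ p) q h with coef-≈ h zero
... | refl = ≈-trans (shift-⊗ p q) (false∷-zero (⊗-zeroˡ p q (∷-tail-zero h)))

⊗-congˡ : ∀ p p′ q → p ≈ p′ → p ⊗ q ≈ p′ ⊗ q
⊗-congˡ []      p′        q h = ≈-sym (⊗-zeroˡ p′ q (≈-sym h))
⊗-congˡ (a ∷ p) []        q h = ⊗-zeroˡ (a ∷ p) q h
⊗-congˡ (a ∷ p) (a′ ∷ p′) q h with coef-≈ h zero
... | refl = ⊕-cong (≈-refl {scale a q}) (∷-cong refl (⊗-congˡ p p′ q (∷-tail h)))

⊗-zeroʳ : ∀ p → p ⊗ [] ≈ []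
⊗-zeroʳ []      = ≈-refl
⊗-zeroʳ (a ∷ p) = false∷-zero (⊗-zeroʳ p)

⊗-consʳ : ∀ p a q → p ⊗ (a ∷ q) ≈ scale a p ⊕ (false ∷ p ⊗ q)
⊗-consʳ []      a q = ≈-sym (false∷-zero ≈-refl)
⊗-consʳ (b ∷ p) a q = ∷-cong (cong (_xor false) (∧-comm b a))
  (≈-trans (⊕-cong (≈-refl {scale b q}) (⊗-consʳ p a q))
           (⊕-swap (scale b q) (scale a p) (false ∷ p ⊗ q)))

⊗-comm : ∀ p q → p ⊗ q ≈ q ⊗ p
⊗-comm []      q = ≈-sym (⊗-zeroʳ q)
⊗-comm (a ∷ p) q =
  ≈-trans (⊕-cong (≈-refl {scale a q}) (∷-cong refl (⊗-comm p q))) (≈-sym (⊗-consʳ q a p))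

⊗-congʳ : ∀ p q q′ → q ≈ q′ → p ⊗ q ≈ p ⊗ q′
⊗-congʳ p q q′ h = ≈-trans (⊗-comm p q) (≈-trans (⊗-congˡ q q′ p h) (⊗-comm q′ p))

⊗-cong : ∀ {p p′ q q′} → p ≈ p′ → q ≈ q′ → p ⊗ q ≈ p′ ⊗ q′
⊗-cong {p} {p′} {q} {q′} h h′ = ≈-trans (⊗-congˡ p p′ q h) (⊗-congʳ p′ q q′ h′)

⊗-distribʳ : ∀ p p′ q → (p ⊕ p′) ⊗ q ≈ p ⊗ q ⊕ p′ ⊗ q
⊗-distribʳ []      p′       q = ≈-refl
⊗-distribʳ (a ∷ p) []       q = ≈-sym (⊕-identityʳ _)
⊗-distribʳ (a ∷ p) (b ∷ p′) q =
  ≈-trans (⊕-cong (scale-xor a b q) (∷-cong refl (⊗-distribʳ p p′ q)))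
          (⊕-interchange (scale a q) (scale b q) (false ∷ p ⊗ q) (false ∷ p′ ⊗ q))

⊗-distribˡ : ∀ p q q′ → p ⊗ (q ⊕ q′) ≈ p ⊗ q ⊕ p ⊗ q′
⊗-distribˡ p q q′ = ≈-trans (⊗-comm p (q ⊕ q′))
  (≈-trans (⊗-distribʳ q q′ p) (⊕-cong (⊗-comm q p) (⊗-comm q′ p)))

scale-⊗ : ∀ a p q → scale a p ⊗ q ≈ scale a (p ⊗ q)
scale-⊗ a []      q = ≈-refl
scale-⊗ a (b ∷ p) q =
  ≈-trans (⊕-cong (scale-∧ a b q) (∷-cong (sym (∧-zeroʳ a)) (scale-⊗ a p q)))
          (≈-sym (scale-⊕ a (scale b q) (false ∷ p ⊗ q)))

⊗-assoc : ∀ p q r → p ⊗ q ⊗ r ≈ p ⊗ (q ⊗ r)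
⊗-assoc []      q r = ≈-refl
⊗-assoc (a ∷ p) q r =
  ≈-trans (⊗-distribʳ (scale a q) (false ∷ p ⊗ q) r)
          (⊕-cong (scale-⊗ a q r) (≈-trans (shift-⊗ (p ⊗ q) r) (∷-cong refl (⊗-assoc p q r))))

⊗-identityˡ : ∀ p → (true ∷ []) ⊗ p ≈ p
⊗-identityˡ p = ≈-trans (⊕-cong (scale-true p) (false∷-zero ≈-refl)) (⊕-identityʳ p)

𝔽₂[X]-commutativeRing : CommutativeRing 0ℓ 0ℓ
𝔽₂[X]-commutativeRing = record
  { Carrier = Poly ; _≈_ = _≈_ ; _+_ = _⊕_ ; _*_ = _⊗_ ; -_ = λ p → p ; 0# = [] ; 1# = true ∷ []
  ; isCommutativeRing = record
    { isRing = record
      { +-isAbelianGroup = record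
        { isGroup = record
          { isMonoid = record
            { isSemigroup = record
              { isMagma = record
                { isEquivalence = record { refl = ≈-refl ; sym = ≈-sym ; trans = ≈-trans }
                ; ∙-cong = ⊕-cong }
              ; assoc = ⊕-assoc }
            ; identity = (λ _ → ≈-refl) , ⊕-identityʳ }
          ; inverse = ⊕-self , ⊕-self
          ; ⁻¹-cong = λ h → h }
        ; comm = ⊕-comm }
      ; *-cong = ⊗-cong
      ; *-assoc = ⊗-assoc
      ; *-identity = ⊗-identityˡ , (λ p → ≈-trans (⊗-comm p _) (⊗-identityˡ p))
      ; distrib = ⊗-distribˡ , (λ q p p′ → ⊗-distribʳ p p′ q) }
    ; *-comm = ⊗-comm } }

𝔽₂[X] : ACR.AlmostCommutativeRing 0ℓ 0ℓ
𝔽₂[X] = ACR.fromCommutativeRing 𝔽₂[X]-commutativeRing (λ _ → nothing)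

infix 4 _≈[_]_
record _≈[_]_ (p : Poly) (N : ℕ) (q : Poly) : Set where
  constructor below
  field coef-≈[] : ∀ k → k < N → coef p k ≡ coef q k
open _≈[_]_

≈⇒≈[] : ∀ {p q N} → p ≈ q → p ≈[ N ] q
≈⇒≈[] h = below λ k _ → coef-≈ h k

≈[]-refl : ∀ {p N} → p ≈[ N ] p
≈[]-refl = below λ _ _ → refl

≈[]-trans : ∀ {p q r N} → p ≈[ N ] q → q ≈[ N ] r → p ≈[ N ] r
≈[]-trans h h′ = below λ k k<N → trans (coef-≈[] h k k<N) (coef-≈[] h′ k k<N)

≈[]-trans≈ : ∀ {p q r N} → p ≈[ N ] q → q ≈ r → p ≈[ N ] r
≈[]-trans≈ h h′ = ≈[]-trans h (≈⇒≈[] h′)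

≈-trans≈[] : ∀ {p q r N} → p ≈ q → q ≈[ N ] r → p ≈[ N ] r
≈-trans≈[] h h′ = ≈[]-trans (≈⇒≈[] h) h′

≈[]-zero-∷ : ∀ {a p N} → a ∷ p ≈[ suc N ] [] → p ≈[ N ] []
≈[]-zero-∷ h = below λ k k<N → coef-≈[] h (suc k) (s≤s k<N)

false∷-zero[] : ∀ {p N} → p ≈[ N ] [] → false ∷ p ≈[ suc N ] []
false∷-zero[] h = below λ { zero _ → refl ; (suc k) (s≤s k<N) → coef-≈[] h k k<N }

⊕-cong[] : ∀ {p p′ q q′ N} → p ≈[ N ] p′ → q ≈[ N ] q′ → p ⊕ q ≈[ N ] p′ ⊕ q′
⊕-cong[] {p} {p′} {q} {q′} h h′ = below λ k k<N →
  trans (coef-⊕ p q k)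
  (trans (cong₂ _xor_ (coef-≈[] h k k<N) (coef-≈[] h′ k k<N)) (sym (coef-⊕ p′ q′ k)))

-- The k-th coefficient of p ⊗ q only involves coefficients of p of index ≤ k.
⊗-zero[] : ∀ N p q → p ≈[ N ] [] → p ⊗ q ≈[ N ] []
⊗-zero[] zero    p       q h = below λ _ ()
⊗-zero[] (suc N) []      q h = ≈[]-refl
⊗-zero[] (suc N) (a ∷ p) q h with coef-≈[] h zero (s≤s z≤n)
... | refl = ≈-trans≈[] (shift-⊗ p q) (false∷-zero[] (⊗-zero[] N p q (≈[]-zero-∷ h)))

⊗-congˡ[] : ∀ {N} p p′ q → p ≈[ N ] p′ → p ⊗ q ≈[ N ] p′ ⊗ q
⊗-congˡ[] {N} p p′ q h = below λ k k<N → xor≡false⇒≡ _ _ (begin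
  coef (p ⊗ q) k xor coef (p′ ⊗ q) k ≡⟨ coef-⊕ (p ⊗ q) (p′ ⊗ q) k ⟨
  coef (p ⊗ q ⊕ p′ ⊗ q) k             ≡⟨ coef-≈ (⊗-distribʳ p p′ q) k ⟨
  coef ((p ⊕ p′) ⊗ q) k               ≡⟨ coef-≈[] (⊗-zero[] N (p ⊕ p′) q difference) k k<N ⟩
  false                               ∎)
  where
  open ≡-Reasoning
  difference : p ⊕ p′ ≈[ N ] []
  difference = below λ j j<N →
    trans (coef-⊕ p p′ j) (trans (cong (_xor coef p′ j) (coef-≈[] h j j<N)) (xor-same (coef p′ j)))

⊗-cong[] : ∀ {N p p′ q q′} → p ≈[ N ] p′ → q ≈[ N ] q′ → p ⊗ q ≈[ N ] p′ ⊗ q′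
⊗-cong[] {N} {p} {p′} {q} {q′} h h′ =
  ≈[]-trans (⊗-congˡ[] p p′ q h)
  (≈-trans≈[] (⊗-comm p′ q) (≈[]-trans≈ (⊗-congˡ[] q q′ p′ h′) (⊗-comm q′ p′)))

-- A polynomial with constant term 1 is a unit modulo X^N, hence cancellable.
cancel[] : ∀ N p u → coef u zero ≡ true → p ⊗ u ≈[ N ] [] → p ≈[ N ] []
cancel[] zero    p       u u₀ h = below λ _ ()
cancel[] (suc N) []      u u₀ h = ≈[]-refl
cancel[] (suc N) (a ∷ p) u u₀ h = subst (λ a → a ∷ p ≈[ suc N ] []) (sym a≡false)
  (false∷-zero[] (cancel[] N p u u₀ (≈[]-zero-∷ (≈-trans≈[] (≈-sym (shift-⊗ p u)) h₀))))
  where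
  a≡false : a ≡ false
  a≡false = begin
    a                           ≡⟨ ∧-identityʳ a ⟨
    a ∧ true                    ≡⟨ cong (a ∧_) u₀ ⟨
    a ∧ coef u zero             ≡⟨ xor-identityʳ _ ⟨
    (a ∧ coef u zero) xor false ≡⟨ coef-⊗ a u (p ⊗ u) zero ⟨
    coef ((a ∷ p) ⊗ u) zero     ≡⟨ coef-≈[] h zero (s≤s z≤n) ⟩
    false                       ∎
    where open ≡-Reasoning
  h₀ : (false ∷ p) ⊗ u ≈[ suc N ] []
  h₀ = subst (λ a → (a ∷ p) ⊗ u ≈[ suc N ] []) a≡false h

cancel : ∀ p u → coef u zero ≡ true → p ⊗ u ≈ [] → p ≈ []
cancel p u u₀ h = coefwise λ k → coef-≈[] (cancel[] (suc k) p u u₀ (≈⇒≈[] h)) k ≤-refl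

X : Poly
X = false ∷ true ∷ []

1+X : Poly
1+X = true ∷ true ∷ []

Q : Poly → Poly → Poly
Q f g = g ⊗ g ⊗ g ⊕ X ⊗ f ⊗ f ⊗ g ⊕ f ⊗ f ⊗ f

Q-cong : ∀ {f f′ g g′} → f ≈ f′ → g ≈ g′ → Q f g ≈ Q f′ g′
Q-cong hf hg =
  ⊕-cong (⊕-cong (⊗-cong (⊗-cong hg hg) hg) (⊗-cong (⊗-cong (⊗-cong (≈-refl {X}) hf) hf) hg))
         (⊗-cong (⊗-cong hf hf) hf)

Q-homogeneous : ∀ h f g → Q (h ⊗ f) (h ⊗ g) ≈ Q f g ⊗ h ⊗ h ⊗ h
Q-homogeneous h f g = identity X h f g
  where
  identity : ∀ x h f g →
    (h ⊗ g) ⊗ (h ⊗ g) ⊗ (h ⊗ g) ⊕ x ⊗ (h ⊗ f) ⊗ (h ⊗ f) ⊗ (h ⊗ g)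
      ⊕ (h ⊗ f) ⊗ (h ⊗ f) ⊗ (h ⊗ f)
      ≈ (g ⊗ g ⊗ g ⊕ x ⊗ f ⊗ f ⊗ g ⊕ f ⊗ f ⊗ f) ⊗ h ⊗ h ⊗ h
  identity = RingSolver.solve-∀ 𝔽₂[X]

-- Evaluation at X = 1 is a ring homomorphism 𝔽₂[X] → 𝔽₂.
eval : Poly → Bool
eval []      = false
eval (a ∷ p) = a xor eval p

eval-⊕ : ∀ p q → eval (p ⊕ q) ≡ eval p xor eval q
eval-⊕ []      q       = refl
eval-⊕ (a ∷ p) []      = sym (xor-identityʳ _)
eval-⊕ (a ∷ p) (b ∷ q) = trans (cong ((a xor b) xor_) (eval-⊕ p q)) (interchange a b (eval p) (eval q))
  where
  interchange : ∀ a b c d → (a xor b) xor (c xor d) ≡ (a xor c) xor (b xor d)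
  interchange = RingSolver.solve-∀ 𝔽₂

eval-scale : ∀ a p → eval (scale a p) ≡ a ∧ eval p
eval-scale a []      = sym (∧-zeroʳ a)
eval-scale a (b ∷ p) = trans (cong ((a ∧ b) xor_) (eval-scale a p)) (sym (Bool.∧-distribˡ-xor a b (eval p)))

eval-⊗ : ∀ p q → eval (p ⊗ q) ≡ eval p ∧ eval q
eval-⊗ []      q = refl
eval-⊗ (a ∷ p) q = trans (eval-⊕ (scale a q) (false ∷ p ⊗ q))
  (trans (cong₂ _xor_ (eval-scale a q) (eval-⊗ p q)) (sym (Bool.∧-distribʳ-xor (eval q) a (eval p))))

eval-zero : ∀ p → p ≈ [] → eval p ≡ false
eval-zero []      h = refl
eval-zero (a ∷ p) h with coef-≈ h zero
... | refl = eval-zero p (∷-tail-zero h)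

eval-Q : ∀ f g → eval (Q f g) ≡
  (((eval g ∧ eval g) ∧ eval g) xor ((eval f ∧ eval f) ∧ eval g)) xor ((eval f ∧ eval f) ∧ eval f)
eval-Q f g = begin
  eval (Q f g)
    ≡⟨ eval-⊕ (g ⊗ g ⊗ g ⊕ X ⊗ f ⊗ f ⊗ g) (f ⊗ f ⊗ f) ⟩
  eval (g ⊗ g ⊗ g ⊕ X ⊗ f ⊗ f ⊗ g) xor eval (f ⊗ f ⊗ f)
    ≡⟨ cong₂ _xor_ (eval-⊕ (g ⊗ g ⊗ g) (X ⊗ f ⊗ f ⊗ g)) (eval-cube f) ⟩
  (eval (g ⊗ g ⊗ g) xor eval (X ⊗ f ⊗ f ⊗ g)) xor ((eval f ∧ eval f) ∧ eval f)
    ≡⟨ cong (λ z → z xor ((eval f ∧ eval f) ∧ eval f)) (cong₂ _xor_ (eval-cube g) eval-middle) ⟩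
  (((eval g ∧ eval g) ∧ eval g) xor ((eval f ∧ eval f) ∧ eval g)) xor ((eval f ∧ eval f) ∧ eval f) ∎
  where
  open ≡-Reasoning
  eval-cube : ∀ p → eval (p ⊗ p ⊗ p) ≡ (eval p ∧ eval p) ∧ eval p
  eval-cube p = trans (eval-⊗ (p ⊗ p) p) (cong (_∧ eval p) (eval-⊗ p p))
  eval-middle : eval (X ⊗ f ⊗ f ⊗ g) ≡ (eval f ∧ eval f) ∧ eval g
  eval-middle = trans (eval-⊗ (X ⊗ f ⊗ f) g)
    (cong (_∧ eval g) (trans (eval-⊗ (X ⊗ f) f) (cong (_∧ eval f) (eval-⊗ X f))))

cubic-zero : ∀ x y → (((y ∧ y) ∧ y) xor ((x ∧ x) ∧ y)) xor ((x ∧ x) ∧ x) ≡ false →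
             x ≡ false × y ≡ false
cubic-zero false false _  = refl , refl
cubic-zero false true  ()
cubic-zero true  false ()
cubic-zero true  true  ()

-- Exact division by 1 + X of a polynomial vanishing at 1.  With accumulator c, the
-- quotient is that of the polynomial whose constant term is shifted by c.
quotient′ : Bool → Poly → Poly
quotient′ c []          = []
quotient′ c (a ∷ [])    = []
quotient′ c (a ∷ b ∷ p) = (c xor a) ∷ quotient′ (c xor a) (b ∷ p)

quotient : Poly → Poly
quotient = quotient′ false

length-quotient′ : ∀ c a p → length (quotient′ c (a ∷ p)) ≡ length p
length-quotient′ c a []      = refl
length-quotient′ c a (b ∷ p) = cong suc (length-quotient′ (c xor a) b p)

quotient′-spec : ∀ c a p → c xor eval (a ∷ p) ≡ false →
                 1+X ⊗ quotient′ c (a ∷ p) ≈ (c xor a) ∷ p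
quotient′-spec c a [] e =
  ≈-trans (⊗-zeroʳ 1+X) (≈-sym (false∷-zero-head (trans (cong (c xor_) (sym (xor-identityʳ a))) e)))
  where
  false∷-zero-head : ∀ {x} → x ≡ false → x ∷ [] ≈ []
  false∷-zero-head refl = false∷-zero ≈-refl
quotient′-spec c a (b ∷ p) e =
  ≈-trans (⊗-consʳ 1+X c′ (quotient′ c′ (b ∷ p)))
  (≈-trans (⊕-cong (≈-refl {scale c′ 1+X})
                   (∷-cong refl (quotient′-spec c′ b p (trans (xor-assoc c a _) e))))
           (∷-cong head (∷-cong next ≈-refl)))
  where
  c′ : Bool
  c′ = c xor a
  head : (c′ ∧ true) xor false ≡ c′
  head = trans (xor-identityʳ _) (∧-identityʳ c′)
  next : (c′ ∧ true) xor (c′ xor b) ≡ b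
  next = trans (cong (_xor (c′ xor b)) (∧-identityʳ c′)) (xor-cancelˡ c′ b)

factor-1+X : ∀ p → eval p ≡ false → 1+X ⊗ quotient p ≈ p
factor-1+X []      _ = ⊗-zeroʳ 1+X
factor-1+X (a ∷ p) e = quotient′-spec false a p e

coef₀-1+X⊗ : ∀ p → coef (1+X ⊗ p) zero ≡ coef p zero
coef₀-1+X⊗ p = trans (coef-⊗ true p ((true ∷ []) ⊗ p) zero) (xor-identityʳ _)

-- Descent: Q(f, g) ≠ 0 whenever f(0) = 1.  A root forces f(1) = g(1) = 0; dividing
-- f and g by 1 + X and cancelling (1+X)³ gives a root with shorter f.
Q-no-root : ∀ f g → coef f zero ≡ true → ¬ (Q f g ≈ [])
Q-no-root f g = descend (length f) f g ≤-refl
  where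
  descend : ∀ n f g → length f ≤ n → coef f zero ≡ true → ¬ (Q f g ≈ [])
  descend n       []      g _           ()
  descend zero    (a ∷ f) g ()
  descend (suc n) (a ∷ f) g (s≤s |f|≤n) f₀ root =
    descend n f₁ g₁ (subst (_≤ n) (sym (length-quotient′ false a f)) |f|≤n)
      (trans (sym (coef₀-1+X⊗ f₁)) (trans (coef-≈ f≈ zero) f₀))
      (cancel _ 1+X refl (cancel _ 1+X refl (cancel _ 1+X refl
        (≈-trans (≈-sym (Q-homogeneous 1+X f₁ g₁)) (≈-trans (Q-cong f≈ g≈) root)))))
    where
    vanish-at-1 : eval (a ∷ f) ≡ false × eval g ≡ false
    vanish-at-1 = cubic-zero (eval (a ∷ f)) (eval g)
      (trans (sym (eval-Q (a ∷ f) g)) (eval-zero _ root))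
    f₁ g₁ : Poly
    f₁ = quotient (a ∷ f)
    g₁ = quotient g
    f≈ : 1+X ⊗ f₁ ≈ a ∷ f
    f≈ = factor-1+X (a ∷ f) (proj₁ vanish-at-1)
    g≈ : 1+X ⊗ g₁ ≈ g
    g≈ = factor-1+X g (proj₂ vanish-at-1)

prefix : ℕ → (ℕ → Bool) → Poly
prefix zero    u = []
prefix (suc N) u = u zero ∷ prefix N (λ k → u (suc k))

coef-prefix : ∀ N u k → k < N → coef (prefix N u) k ≡ u k
coef-prefix (suc N) u zero    _         = refl
coef-prefix (suc N) u (suc k) (s≤s k<N) = coef-prefix N (λ j → u (suc j)) k k<N

FunctionalEquation : (ℕ → Bool) → Set
FunctionalEquation u =
  ∀ N → let G = prefix N u in G ⊗ G ⊗ (G ⊗ G) ⊕ X ⊗ (G ⊗ G) ⊕ G ≈[ N ] []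

-- Squaring is the Frobenius map: p(X)² = p(X²) in characteristic 2.
spread : Poly → Poly
spread []      = []
spread (a ∷ p) = a ∷ false ∷ spread p

⊕-cancelˡ : ∀ p q → p ⊕ (p ⊕ q) ≈ q
⊕-cancelˡ p q = ≈-trans (≈-sym (⊕-assoc p p q)) (⊕-cong (⊕-self p) (≈-refl {q}))

frobenius : ∀ p → p ⊗ p ≈ spread p
frobenius []      = ≈-refl
frobenius (a ∷ p) = ∷-cong (trans (xor-identityʳ _) (Bool.∧-idem a))
  (≈-trans (⊕-cong (≈-refl {scale a p}) (⊗-consʳ p a p))
  (≈-trans (⊕-cancelˡ (scale a p) (false ∷ p ⊗ p)) (∷-cong refl (frobenius p))))

X-⊗ : ∀ p → X ⊗ p ≈ false ∷ p
X-⊗ p = ≈-trans (shift-⊗ (true ∷ []) p) (∷-cong refl (⊗-identityˡ p))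

coef-spread-even : ∀ p i → coef (spread p) (double i) ≡ coef p i
coef-spread-even []      i       = refl
coef-spread-even (a ∷ p) zero    = refl
coef-spread-even (a ∷ p) (suc i) = coef-spread-even p i

coef-spread-odd : ∀ p i → coef (spread p) (suc (double i)) ≡ false
coef-spread-odd []      i       = refl
coef-spread-odd (a ∷ p) zero    = refl
coef-spread-odd (a ∷ p) (suc i) = coef-spread-odd p i

data Mod4 : ℕ → Set where
  4q   : ∀ q → Mod4 (double (double q))
  4q+1 : ∀ q → Mod4 (suc (double (double q)))
  4q+2 : ∀ q → Mod4 (double (suc (double q)))
  4q+3 : ∀ q → Mod4 (suc (double (suc (double q))))

mod4 : ∀ k → Mod4 k
mod4 zero = 4q zero
mod4 (suc k) with mod4 k
... | 4q   q = 4q+1 q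
... | 4q+1 q = 4q+2 q
... | 4q+2 q = 4q+3 q
... | 4q+3 q = 4q (suc q)

record Recursions (u : ℕ → Bool) : Set where
  field
    at-odd  : ∀ i → u (suc (double i)) ≡ u i
    at-4q   : ∀ q → u (double (double q)) ≡ u q
    at-4q+2 : ∀ q → u (double (suc (double q))) ≡ false

baumSweet-recursions : Recursions baumSweet
baumSweet-recursions = record
  { at-odd = baumSweet-odd ; at-4q = baumSweet-4n ; at-4q+2 = baumSweet-4n+2 }

-- Coefficientwise, the recursions say G(X⁴) + X G(X²) = G (mod X^N), case by case mod 4.
recursions-coefficient : ∀ u → Recursions u → ∀ N k → Mod4 k → k < N →
  coef (spread (spread (prefix N u))) k xor coef (false ∷ spread (prefix N u)) k ≡ coef (prefix N u) k
recursions-coefficient u rec N _ (4q q) k<N = begin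
  coef (spread (spread G)) (double (double q)) xor coef (false ∷ spread G) (double (double q))
    ≡⟨ cong₂ _xor_ (trans (coef-spread-even (spread G) (double q)) (coef-spread-even G q)) (shifted q) ⟩
  coef G q xor false            ≡⟨ xor-identityʳ _ ⟩
  coef G q
    ≡⟨ coef-prefix N u _ (≤-<-trans (≤-trans (n≤double q) (n≤double (double q))) k<N) ⟩
  u q                           ≡⟨ at-4q q ⟨
  u (double (double q))         ≡⟨ coef-prefix N u _ k<N ⟨
  coef G (double (double q))    ∎
  where
  open ≡-Reasoning
  open Recursions rec
  G : Poly
  G = prefix N u
  shifted : ∀ q → coef (false ∷ spread G) (double (double q)) ≡ false
  shifted zero    = refl
  shifted (suc q) = coef-spread-odd G (suc (double q))
recursions-coefficient u rec N _ (4q+1 q) k<N = begin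
  coef (spread (spread G)) (suc (double (double q))) xor coef (spread G) (double (double q))
    ≡⟨ cong₂ _xor_ (coef-spread-odd (spread G) (double q)) (coef-spread-even G (double q)) ⟩
  coef G (double q)
    ≡⟨ coef-prefix N u _ (≤-<-trans (≤-trans (n≤double (double q)) (n≤1+n _)) k<N) ⟩
  u (double q)                     ≡⟨ at-odd (double q) ⟨
  u (suc (double (double q)))      ≡⟨ coef-prefix N u _ k<N ⟨
  coef G (suc (double (double q))) ∎
  where
  open ≡-Reasoning
  open Recursions rec
  G : Poly
  G = prefix N u
recursions-coefficient u rec N _ (4q+2 q) k<N = begin
  coef (spread (spread G)) (double (suc (double q))) xor coef (spread G) (suc (double (double q)))
    ≡⟨ cong₂ _xor_ (trans (coef-spread-even (spread G) (suc (double q))) (coef-spread-odd G q))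
                   (coef-spread-odd G (double q)) ⟩
  false                            ≡⟨ at-4q+2 q ⟨
  u (double (suc (double q)))      ≡⟨ coef-prefix N u _ k<N ⟨
  coef G (double (suc (double q))) ∎
  where
  open ≡-Reasoning
  open Recursions rec
  G : Poly
  G = prefix N u
recursions-coefficient u rec N _ (4q+3 q) k<N = begin
  coef (spread (spread G)) (suc (double (suc (double q)))) xor coef (spread G) (double (suc (double q)))
    ≡⟨ cong₂ _xor_ (coef-spread-odd (spread G) (suc (double q))) (coef-spread-even G (suc (double q))) ⟩
  coef G (suc (double q))
    ≡⟨ coef-prefix N u _ (≤-<-trans (≤-trans (n≤double (suc (double q))) (n≤1+n _)) k<N) ⟩
  u (suc (double q))                     ≡⟨ at-odd (suc (double q)) ⟨
  u (suc (double (suc (double q))))      ≡⟨ coef-prefix N u _ k<N ⟨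
  coef G (suc (double (suc (double q)))) ∎
  where
  open ≡-Reasoning
  open Recursions rec
  G : Poly
  G = prefix N u

-- Squaring twice and once (Frobenius) turns the coefficient identities into G⁴ + X G² + G ≡ 0.
recursions⇒equation : ∀ u → Recursions u → FunctionalEquation u
recursions⇒equation u rec N =
  ≈-trans≈[] (⊕-cong (⊕-cong fourth-power shifted-square) (≈-refl {G}))
  (below λ k k<N → trans (coef-⊕ (spread (spread G) ⊕ (false ∷ spread G)) G k)
    (trans (cong (_xor coef G k) (trans (coef-⊕ (spread (spread G)) (false ∷ spread G) k)
                                        (recursions-coefficient u rec N k (mod4 k) k<N)))
           (xor-same (coef G k))))
  where
  G : Poly
  G = prefix N u
  fourth-power : G ⊗ G ⊗ (G ⊗ G) ≈ spread (spread G)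
  fourth-power = ≈-trans (⊗-cong (frobenius G) (frobenius G)) (frobenius (spread G))
  shifted-square : X ⊗ (G ⊗ G) ≈ false ∷ spread G
  shifted-square = ≈-trans (X-⊗ (G ⊗ G)) (∷-cong refl (frobenius G))

Deg : Poly → ℕ → Set
Deg p d = ∀ k → d < k → coef p k ≡ false

deg-weaken : ∀ {p d d′} → d ≤ d′ → Deg p d → Deg p d′
deg-weaken d≤d′ h k d′<k = h k (≤-<-trans d≤d′ d′<k)

deg-⊕ : ∀ p q {d} → Deg p d → Deg q d → Deg (p ⊕ q) d
deg-⊕ p q hp hq k d<k = trans (coef-⊕ p q k) (cong₂ _xor_ (hp k d<k) (hq k d<k))

deg-⊗ : ∀ p q a c → Deg p a → Deg q c → Deg (p ⊗ q) (a + c)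
deg-⊗ []      q a c hp hq k _     = refl
deg-⊗ (x ∷ p) q a c hp hq k a+c<k = trans (coef-⊗ x q (p ⊗ q) k)
  (cong₂ _xor_ (trans (cong (x ∧_) (hq k (≤-<-trans (m≤n+m c a) a+c<k))) (∧-zeroʳ x))
               (shifted a k hp a+c<k))
  where
  shifted : ∀ a k → Deg (x ∷ p) a → a + c < k → coef (false ∷ p ⊗ q) k ≡ false
  shifted a       zero    _  ()
  shifted zero    (suc k) hp _ = coef-≈ (⊗-zeroˡ p q (coefwise λ j → hp (suc j) (s≤s z≤n))) k
  shifted (suc a) (suc k) hp (s≤s a+c<k) = deg-⊗ p q a c (λ j a<j → hp (suc j) (s≤s a<j)) hq k a+c<k

deg-X : Deg X 1
deg-X (suc zero)    (s≤s ())
deg-X (suc (suc k)) _ = refl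

≈[]-deg : ∀ {p N} d → p ≈[ N ] [] → Deg p d → d < N → p ≈ []
≈[]-deg {p} {N} d h hd d<N = coefwise λ k → case (k <? N)
  where
  case : ∀ {k} → Dec (k < N) → coef p k ≡ false
  case {k} (yes k<N) = coef-≈[] h k k<N
  case {k} (no  k≮N) = hd k (<-≤-trans d<N (≮⇒≥ k≮N))

deg-Q : ∀ f g L → Deg f (suc L) → Deg g L → Deg (Q f g) (3 * suc L)
deg-Q f g L df dg =
  deg-⊕ (g ⊗ g ⊗ g ⊕ X ⊗ f ⊗ f ⊗ g) (f ⊗ f ⊗ f) (deg-⊕ (g ⊗ g ⊗ g) (X ⊗ f ⊗ f ⊗ g)
    (deg-weaken {g ⊗ g ⊗ g} (cube≤ L) (deg-⊗ (g ⊗ g) g _ L (deg-⊗ g g L L dg dg) dg))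
    (subst (Deg (X ⊗ f ⊗ f ⊗ g)) (middle L)
      (deg-⊗ (X ⊗ f ⊗ f) g _ L (deg-⊗ (X ⊗ f) f _ _ (deg-⊗ X f 1 _ deg-X df) df) dg)))
  (subst (Deg (f ⊗ f ⊗ f)) (cube L) (deg-⊗ (f ⊗ f) f _ _ (deg-⊗ f f _ _ df df) df))
  where
  cube≤ : ∀ L → (L + L) + L ≤ 3 * suc L
  cube≤ L = subst ((L + L) + L ≤_) (plus3 L) (m≤m+n _ 3)
    where
    plus3 : ∀ L → (L + L) + L + 3 ≡ 3 * suc L
    plus3 = solve-∀
  middle : ∀ L → ((1 + suc L) + suc L) + L ≡ 3 * suc L
  middle = solve-∀
  cube : ∀ L → (suc L + suc L) + suc L ≡ 3 * suc L
  cube = solve-∀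

-- A recurrence is a coefficient list t = (c₀,…,c_{L-1}); predict t u n = Σᵢ cᵢ u_{n+i}
-- is the value it assigns to u_{n+L}.
predict : List Bool → (ℕ → Bool) → ℕ → Bool
predict []      u n = false
predict (a ∷ t) u n = (a ∧ u n) xor predict t u (suc n)

Generates : (ℕ → Bool) → List Bool → ℕ → Set
Generates u t N = ∀ n → n + length t < N → u (n + length t) ≡ predict t u n

monomial : ℕ → Bool → Poly
monomial zero    a = a ∷ []
monomial (suc k) a = false ∷ monomial k a

coef-monomial-⊗ : ∀ k a q n → coef (monomial k a ⊗ q) (k + n) ≡ a ∧ coef q n
coef-monomial-⊗ zero    a q n = trans (coef-≈ constant n) (coef-scale a q n)
  where
  constant : monomial zero a ⊗ q ≈ scale a q
  constant = ≈-trans (⊕-cong (≈-refl {scale a q}) (false∷-zero ≈-refl)) (⊕-identityʳ (scale a q))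
coef-monomial-⊗ (suc k) a q n =
  trans (coef-≈ (shift-⊗ (monomial k a) q) (suc (k + n))) (coef-monomial-⊗ k a q n)

deg-monomial : ∀ k a → Deg (monomial k a) k
deg-monomial zero    a (suc j) _         = refl
deg-monomial (suc k) a (suc j) (s≤s k<j) = deg-monomial k a j k<j

-- The characteristic polynomial 1 + Σᵢ cᵢ X^{L-i} of the recurrence (c₀,…,c_{L-1}).
charPoly : List Bool → Poly
charPoly []      = true ∷ []
charPoly (a ∷ t) = monomial (suc (length t)) a ⊕ charPoly t

charPoly₀ : ∀ t → coef (charPoly t) zero ≡ true
charPoly₀ []      = refl
charPoly₀ (a ∷ t) =
  trans (coef-⊕ (monomial (suc (length t)) a) (charPoly t) zero) (cong (false xor_) (charPoly₀ t))

deg-charPoly : ∀ t → Deg (charPoly t) (length t)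
deg-charPoly []      (suc k) _ = refl
deg-charPoly (a ∷ t) = deg-⊕ (monomial (suc (length t)) a) (charPoly t)
  (deg-monomial (suc (length t)) a) (deg-weaken {charPoly t} (n≤1+n _) (deg-charPoly t))

-- Multiplying by the characteristic polynomial turns the recurrence into the vanishing
-- of coefficients: the coefficient of X^{L+n} in F·G is u_{n+L} + Σᵢ cᵢ u_{n+i}.
coef-charPoly-⊗ : ∀ t N u n → length t + n < N →
  coef (charPoly t ⊗ prefix N u) (length t + n) ≡ u (n + length t) xor predict t u n
coef-charPoly-⊗ [] N u n n<N = begin
  coef ((true ∷ []) ⊗ prefix N u) n ≡⟨ coef-≈ (⊗-identityˡ (prefix N u)) n ⟩
  coef (prefix N u) n               ≡⟨ coef-prefix N u n n<N ⟩
  u n                               ≡⟨ cong u (+-identityʳ n) ⟨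
  u (n + 0)                         ≡⟨ xor-identityʳ _ ⟨
  u (n + 0) xor false               ∎
  where open ≡-Reasoning
coef-charPoly-⊗ (a ∷ t) N u n L+n<N = begin
  coef ((monomial (suc L) a ⊕ charPoly t) ⊗ G) (suc L + n)
    ≡⟨ coef-≈ (⊗-distribʳ (monomial (suc L) a) (charPoly t) G) (suc L + n) ⟩
  coef (monomial (suc L) a ⊗ G ⊕ charPoly t ⊗ G) (suc L + n)
    ≡⟨ coef-⊕ (monomial (suc L) a ⊗ G) (charPoly t ⊗ G) (suc L + n) ⟩
  coef (monomial (suc L) a ⊗ G) (suc L + n) xor coef (charPoly t ⊗ G) (suc (L + n))
    ≡⟨ cong₂ _xor_ (coef-monomial-⊗ (suc L) a G n) (cong (coef (charPoly t ⊗ G)) (sym (+-suc L n))) ⟩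
  (a ∧ coef G n) xor coef (charPoly t ⊗ G) (L + suc n)
    ≡⟨ cong₂ _xor_ (cong (a ∧_) (coef-prefix N u n (≤-<-trans (m≤n+m n (suc L)) L+n<N)))
                   (coef-charPoly-⊗ t N u (suc n) (subst (_< N) (sym (+-suc L n)) L+n<N)) ⟩
  (a ∧ u n) xor (u (suc n + L) xor predict t u (suc n))
    ≡⟨ swap (a ∧ u n) (u (suc n + L)) (predict t u (suc n)) ⟩
  u (suc n + L) xor ((a ∧ u n) xor predict t u (suc n))
    ≡⟨ cong (λ m → u m xor ((a ∧ u n) xor predict t u (suc n))) (sym (+-suc n L)) ⟩
  u (n + suc L) xor ((a ∧ u n) xor predict t u (suc n)) ∎
  where
  open ≡-Reasoning
  L : ℕ
  L = length t
  G : Poly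
  G = prefix N u
  swap : ∀ x y z → x xor (y xor z) ≡ y xor (x xor z)
  swap = RingSolver.solve-∀ 𝔽₂

coef-take : ∀ L p k → k < L → coef (take L p) k ≡ coef p k
coef-take (suc L) []      k       _         = refl
coef-take (suc L) (a ∷ p) zero    _         = refl
coef-take (suc L) (a ∷ p) (suc k) (s≤s k<L) = coef-take L p k k<L

deg-take : ∀ L p → Deg (take (suc L) p) L
deg-take L p = beyond (suc L) p
  where
  beyond : ∀ L p k → L ≤ k → coef (take L p) k ≡ false
  beyond zero    p       k       _         = refl
  beyond (suc L) []      k       _         = refl
  beyond (suc L) (a ∷ p) (suc k) (s≤s L≤k) = beyond L p k L≤k

coef₀-⊗ : ∀ p q → coef (p ⊗ q) zero ≡ coef p zero ∧ coef q zero
coef₀-⊗ []      q = refl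
coef₀-⊗ (a ∷ p) q = trans (coef-⊗ a q (p ⊗ q) zero) (xor-identityʳ _)

-- If F·G agrees with g modulo X^N, G satisfies the functional equation and g is a unit,
-- then Q(F, g) ≡ 0: indeed g·Q(F, g) ≡ F·G·Q(F, F·G) = F⁴·(G⁴ + X G² + G).
Q-vanishes : ∀ N F G g →
  G ⊗ G ⊗ (G ⊗ G) ⊕ X ⊗ (G ⊗ G) ⊕ G ≈[ N ] [] → g ≈[ N ] F ⊗ G → coef g zero ≡ true →
  Q F g ≈[ N ] []
Q-vanishes N F G g equation g≈FG g₀ = cancel[] N (Q F g) g g₀
  (≈-trans≈[] (⊗-comm (Q F g) g)
  (≈[]-trans (⊗-cong[] g≈FG (Q-congʳ[] g≈FG))
  (≈-trans≈[] (identity X F G)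
  (≈[]-trans≈ (⊗-cong[] (≈[]-refl {F ⊗ F ⊗ F ⊗ F}) equation) (⊗-zeroʳ (F ⊗ F ⊗ F ⊗ F))))))
  where
  Q-congʳ[] : ∀ {g g′} → g ≈[ N ] g′ → Q F g ≈[ N ] Q F g′
  Q-congʳ[] h = ⊕-cong[] (⊕-cong[] (⊗-cong[] (⊗-cong[] h h) h)
    (⊗-cong[] (≈[]-refl {X ⊗ F ⊗ F}) h)) ≈[]-refl
  identity : ∀ x F G →
    (F ⊗ G) ⊗ ((F ⊗ G) ⊗ (F ⊗ G) ⊗ (F ⊗ G) ⊕ x ⊗ F ⊗ F ⊗ (F ⊗ G) ⊕ F ⊗ F ⊗ F)
      ≈ F ⊗ F ⊗ F ⊗ F ⊗ (G ⊗ G ⊗ (G ⊗ G) ⊕ x ⊗ (G ⊗ G) ⊕ G)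
  identity = RingSolver.solve-∀ 𝔽₂[X]

LengthAtLeastThird : (ℕ → Bool) → Set
LengthAtLeastThird u = ∀ N t → 1 ≤ N → Generates u t N → N ≤ 3 * length t

lower-bound : ∀ u → u zero ≡ true → FunctionalEquation u → LengthAtLeastThird u
lower-bound u u₀ fe N []      1≤N gen with trans (sym u₀) (gen 0 1≤N)
... | ()
lower-bound u u₀ fe N (a ∷ t) 1≤N gen with N ≤? 3 * suc (length t)
... | yes N≤3L = N≤3L
... | no  N≰3L = ⊥-elim (Q-no-root F g (charPoly₀ (a ∷ t)) Q≈0)
  where
  L : ℕ
  L = suc (length t)
  F G g : Poly
  F = charPoly (a ∷ t)
  G = prefix N u
  g = take L (F ⊗ G)
  -- The coefficients of F·G of index in [L, N) vanish, so g is its truncation mod X^N.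
  g≈FG : g ≈[ N ] F ⊗ G
  g≈FG = below λ k k<N → case k k<N (k <? L)
    where
    case : ∀ k → k < N → Dec (k < L) → coef g k ≡ coef (F ⊗ G) k
    case k k<N (yes k<L) = coef-take L (F ⊗ G) k k<L
    case k k<N (no  k≮L) with m≤n⇒∃[o]m+o≡n (≮⇒≥ k≮L)
    ... | n , refl = trans (deg-take (length t) (F ⊗ G) (L + n) (s≤s (m≤m+n _ n)))
      (sym (trans (coef-charPoly-⊗ (a ∷ t) N u n k<N)
                  (trans (cong (_xor predict (a ∷ t) u n) (gen n (subst (_< N) (+-comm L n) k<N)))
                         (xor-same (predict (a ∷ t) u n)))))
  g₀ : coef g zero ≡ true
  g₀ = trans (coef-take L (F ⊗ G) zero (s≤s z≤n))
    (trans (coef₀-⊗ F G) (cong₂ _∧_ (charPoly₀ (a ∷ t)) (trans (coef-prefix N u zero 1≤N) u₀)))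
  -- 3L < N, so Q(F, g), of degree ≤ 3L and vanishing modulo X^N, is zero.
  Q≈0 : Q F g ≈ []
  Q≈0 = ≈[]-deg (3 * L) (Q-vanishes N F G g (fe N) g≈FG g₀)
    (deg-Q F g (length t) (deg-charPoly (a ∷ t)) (deg-take (length t) (F ⊗ G))) (≰⇒> N≰3L)

predict-⊕ : ∀ p q u n → predict (p ⊕ q) u n ≡ predict p u n xor predict q u n
predict-⊕ []      q       u n = refl
predict-⊕ (a ∷ p) []      u n = sym (xor-identityʳ _)
predict-⊕ (a ∷ p) (b ∷ q) u n =
  trans (cong (((a xor b) ∧ u n) xor_) (predict-⊕ p q u (suc n)))
        (regroup a b (u n) (predict p u (suc n)) (predict q u (suc n)))
  where
  regroup : ∀ a b x y z → ((a xor b) ∧ x) xor (y xor z) ≡ ((a ∧ x) xor y) xor ((b ∧ x) xor z)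
  regroup = RingSolver.solve-∀ 𝔽₂

predict-++ : ∀ p q u n → predict (p ++ q) u n ≡ predict p u n xor predict q u (length p + n)
predict-++ []      q u n = refl
predict-++ (a ∷ p) q u n = trans (cong ((a ∧ u n) xor_) (trans (predict-++ p q u (suc n))
    (cong (λ m → predict p u (suc n) xor predict q u m) (+-suc (length p) n))))
  (sym (xor-assoc (a ∧ u n) (predict p u (suc n)) _))

pad : ℕ → List Bool → List Bool
pad k t = replicate k false ++ t

predict-pad : ∀ k t u n → predict (pad k t) u n ≡ predict t u (k + n)
predict-pad zero    t u n = refl
predict-pad (suc k) t u n = trans (predict-pad k t u (suc n)) (cong (predict t u) (+-suc k n))

length-pad : ∀ k t → length (pad k t) ≡ k + length t
length-pad k t = trans (length-++ (replicate k false)) (cong (_+ length t) (length-replicate k))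

length-⊕ : ∀ p q → length (p ⊕ q) ≡ length p ⊔ length q
length-⊕ []      q       = refl
length-⊕ (a ∷ p) []      = refl
length-⊕ (a ∷ p) (b ∷ q) = cong suc (length-⊕ p q)

record BreaksAt (u : ℕ → Bool) (t : List Bool) (m : ℕ) : Set where
  field
    generates : Generates u t m
    start     : ℕ
    start+L≡m : start + length t ≡ m
    mismatch  : u m ≡ not (predict t u start)

extend : ∀ {u t N} → Generates u t N → (∀ n → n + length t ≡ N → u N ≡ predict t u n) →
         Generates u t (suc N)
extend {u} gen last n (s≤s n+L≤N) with m≤n⇒m<n∨m≡n n+L≤N
... | inj₁ n+L<N = gen n n+L<N
... | inj₂ n+L≡N = trans (cong u n+L≡N) (last n n+L≡N)

extend-or-break : ∀ u t N → Generates u t N → Generates u t (suc N) ⊎ BreaksAt u t N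
extend-or-break u t N gen with length t ≤? N
... | no L≰N = inj₁ (extend {u} {t} gen λ n n+L≡N →
        ⊥-elim (L≰N (subst (length t ≤_) n+L≡N (m≤n+m _ n))))
... | yes L≤N with m≤n⇒∃[o]m+o≡n L≤N
... | n₀ , L+n₀≡N with u N Bool.≟ predict t u n₀
... | yes agrees = inj₁ (extend {u} {t} gen λ n n+L≡N →
        trans agrees (cong (predict t u) (+-cancelʳ-≡ (length t) n₀ n (trans n₀+L≡N (sym n+L≡N)))))
  where
  n₀+L≡N : n₀ + length t ≡ N
  n₀+L≡N = trans (+-comm n₀ (length t)) L+n₀≡N
... | no differs = inj₂ (record
  { generates = gen ; start = n₀ ; start+L≡m = trans (+-comm n₀ (length t)) L+n₀≡N
  ; mismatch = ¬-not differs })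

-- If t breaks at N and s broke earlier at m, with
-- N = m + k + 1, then t delayed by k₁ plus the recurrence s ++ [1] delayed by k₂
-- (whose prediction is the defect u_{j+|s|} + Σ sᵢ u_{j+i} of s) repairs t at N
-- without spoiling it before N.
update : ℕ → List Bool → ℕ → List Bool → List Bool
update k₁ t k₂ s = pad k₁ t ⊕ pad k₂ (s ++ true ∷ [])

length-update : ∀ k₁ t k₂ s {k L′} → k₁ + length t ≡ L′ → k₂ + (length s + suc k) ≡ L′ →
                length (update k₁ t k₂ s) ≡ L′
length-update k₁ t k₂ s {k} {L′} eq₁ eq₂ = begin
  length (update k₁ t k₂ s)
    ≡⟨ length-⊕ (pad k₁ t) (pad k₂ (s ++ true ∷ [])) ⟩
  length (pad k₁ t) ⊔ length (pad k₂ (s ++ true ∷ []))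
    ≡⟨ cong₂ _⊔_ (trans (length-pad k₁ t) eq₁) (length-pad k₂ _) ⟩
  L′ ⊔ (k₂ + length (s ++ true ∷ []))
    ≡⟨ m≥n⇒m⊔n≡m (subst (_ ≤_) eq₂ (+-monoʳ-≤ k₂ |s++1|≤)) ⟩
  L′ ∎
  where
  open ≡-Reasoning
  |s++1|≤ : length (s ++ true ∷ []) ≤ length s + suc k
  |s++1|≤ = subst (_≤ length s + suc k) (sym (length-++ s)) (+-monoʳ-≤ (length s) (s≤s z≤n))

predict-update : ∀ k₁ t k₂ s u n → predict (update k₁ t k₂ s) u n ≡
  predict t u (k₁ + n) xor (predict s u (k₂ + n) xor u (length s + (k₂ + n)))
predict-update k₁ t k₂ s u n = begin
  predict (update k₁ t k₂ s) u n
    ≡⟨ predict-⊕ (pad k₁ t) (pad k₂ (s ++ true ∷ [])) u n ⟩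
  predict (pad k₁ t) u n xor predict (pad k₂ (s ++ true ∷ [])) u n
    ≡⟨ cong₂ _xor_ (predict-pad k₁ t u n) (predict-pad k₂ (s ++ true ∷ []) u n) ⟩
  predict t u (k₁ + n) xor predict (s ++ true ∷ []) u (k₂ + n)
    ≡⟨ cong (predict t u (k₁ + n) xor_) (predict-++ s (true ∷ []) u (k₂ + n)) ⟩
  predict t u (k₁ + n) xor (predict s u (k₂ + n) xor (u (length s + (k₂ + n)) xor false))
    ≡⟨ cong (λ x → predict t u (k₁ + n) xor (predict s u (k₂ + n) xor x)) (xor-identityʳ _) ⟩
  predict t u (k₁ + n) xor (predict s u (k₂ + n) xor u (length s + (k₂ + n))) ∎
  where open ≡-Reasoning

update-generates : ∀ {u N m k L′} k₁ t k₂ s → BreaksAt u t N → BreaksAt u s m → m + suc k ≡ N →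
  k₁ + length t ≡ L′ → k₂ + (length s + suc k) ≡ L′ →
  ∀ n → n + L′ < suc N → u (n + L′) ≡ predict (update k₁ t k₂ s) u n
update-generates {u} {N} {m} {k} {L′} k₁ t k₂ s t-breaks s-breaks m+k+1≡N eq₁ eq₂ n (s≤s n+L′≤N)
  =
  trans (value (m≤n⇒m<n∨m≡n n+L′≤N)) (sym (predict-update k₁ t k₂ s u n))
  where
  open BreaksAt
  j₁ j₂ : ℕ
  j₁ = k₁ + n
  j₂ = k₂ + n
  at-t : n + L′ ≡ j₁ + length t
  at-t = trans (cong (n +_) (sym eq₁)) (reassoc k₁ n (length t))
    where
    reassoc : ∀ k₁ n L → n + (k₁ + L) ≡ (k₁ + n) + L
    reassoc = solve-∀
  at-s : n + L′ ≡ (j₂ + length s) + suc k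
  at-s = trans (cong (n +_) (sym eq₂)) (reassoc k₂ n (length s) k)
    where
    reassoc : ∀ k₂ n S k → n + (k₂ + (S + suc k)) ≡ ((k₂ + n) + S) + suc k
    reassoc = solve-∀
  value : n + L′ < N ⊎ n + L′ ≡ N →
    u (n + L′) ≡ predict t u j₁ xor (predict s u j₂ xor u (length s + j₂))
  value (inj₁ n+L′<N) = begin
    u (n + L′)                   ≡⟨ cong u at-t ⟩
    u (j₁ + length t)            ≡⟨ generates t-breaks j₁ (subst (_< N) at-t n+L′<N) ⟩
    predict t u j₁               ≡⟨ xor-identityʳ _ ⟨
    predict t u j₁ xor false     ≡⟨ cong (predict t u j₁ xor_) (xor-same (predict s u j₂)) ⟨
    predict t u j₁ xor (predict s u j₂ xor predict s u j₂)
      ≡⟨ cong (λ x → predict t u j₁ xor (predict s u j₂ xor x)) (sym s-correct) ⟩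
    predict t u j₁ xor (predict s u j₂ xor u (length s + j₂)) ∎
    where
    open ≡-Reasoning
    -- Before N the delayed copy of s is still inside the range that s generates.
    s-correct : u (length s + j₂) ≡ predict s u j₂
    s-correct = trans (cong u (+-comm (length s) j₂)) (generates s-breaks j₂
      (+-cancelʳ-< (suc k) (j₂ + length s) m (subst₂ _<_ at-s (sym m+k+1≡N) n+L′<N)))
  value (inj₂ n+L′≡N) = begin
    u (n + L′)                                         ≡⟨ cong u n+L′≡N ⟩
    u N                                                ≡⟨ mismatch t-breaks ⟩
    not (predict t u (start t-breaks))                 ≡⟨ cong (λ j → not (predict t u j)) j₁≡ ⟨
    not (predict t u j₁)                               ≡⟨ repaired (predict t u j₁) (predict s u j₂) ⟩
    predict t u j₁ xor (predict s u j₂ xor not (predict s u j₂))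
      ≡⟨ cong (λ j → predict t u j₁ xor (predict s u j₂ xor not (predict s u j))) j₂≡ ⟩
    predict t u j₁ xor (predict s u j₂ xor not (predict s u (start s-breaks)))
      ≡⟨ cong (λ x → predict t u j₁ xor (predict s u j₂ xor x)) s-mismatch ⟨
    predict t u j₁ xor (predict s u j₂ xor u (length s + j₂)) ∎
    where
    open ≡-Reasoning
    j₁≡ : j₁ ≡ start t-breaks
    j₁≡ = +-cancelʳ-≡ (length t) j₁ _ (trans (sym at-t) (trans n+L′≡N (sym (start+L≡m t-breaks))))
    j₂+S≡m : j₂ + length s ≡ m
    j₂+S≡m = +-cancelʳ-≡ (suc k) _ m (trans (sym at-s) (trans n+L′≡N (sym m+k+1≡N)))
    j₂≡ : j₂ ≡ start s-breaks
    j₂≡ = +-cancelʳ-≡ (length s) j₂ _ (trans j₂+S≡m (sym (start+L≡m s-breaks)))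
    -- At N the delayed copy of s sits exactly where s broke down.
    s-mismatch : u (length s + j₂) ≡ not (predict s u (start s-breaks))
    s-mismatch = trans (cong u (trans (+-comm (length s) j₂) j₂+S≡m)) (mismatch s-breaks)
    repaired : ∀ x y → not x ≡ x xor (y xor not y)
    repaired x y = sym (trans (cong (x xor_) (Bool.xor-inverseʳ y)) (trans (xor-comm x true) (Bool.true-xor x)))

generates-with-length : ∀ u t {N L} → length t ≡ L →
  (∀ n → n + L < N → u (n + L) ≡ predict t u n) → Generates u t N
generates-with-length u t refl h = h

-- The invariant of the Berlekamp–Massey construction after N terms: a current
-- recurrence with 3L ≤ 2N + 1, and the last recurrence that broke, at some m < N,
-- whose length L′ satisfies L + L′ ≤ m + 1.
record BMState (u : ℕ → Bool) (N : ℕ) : Set where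
  field
    current           : List Bool
    current-generates : Generates u current N
    current-bound     : 3 * length current ≤ 2 * N + 1
    previous          : List Bool
    breakpoint        : ℕ
    breakpoint<N      : breakpoint < N
    previous-breaks   : BreaksAt u previous breakpoint
    lengths           : length current + length previous ≤ suc breakpoint

bm-initial : ∀ u → u zero ≡ true → BMState u 1
bm-initial u u₀ = record
  { current           = false ∷ []
  ; current-generates = λ n n+1<1 → ⊥-elim (<-irrefl refl (≤-<-trans (m≤n+m 1 n) n+1<1))
  ; current-bound     = ≤-refl
  ; previous          = []
  ; breakpoint        = 0
  ; breakpoint<N      = s≤s z≤n
  ; previous-breaks   = record
    { generates = λ n n+0<0 → ⊥-elim (n≮0 n+0<0) ; start = 0 ; start+L≡m = refl ; mismatch = u₀ }
  ; lengths           = ≤-refl }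

bound-weaken : ∀ L N → 3 * L ≤ 2 * N + 1 → 3 * L ≤ 2 * suc N + 1
bound-weaken L N h = ≤-trans h (subst (2 * N + 1 ≤_) (sym (grow N)) (m≤m+n _ 2))
  where
  grow : ∀ N → 2 * suc N + 1 ≡ (2 * N + 1) + 2
  grow = solve-∀

bound-new : ∀ L′ L N → L′ + L ≤ suc N → N ≤ 3 * L → 3 * L′ ≤ 2 * suc N + 1
bound-new L′ L N sum≤ N≤3L = +-cancelʳ-≤ N (3 * L′) (2 * suc N + 1) (begin
  3 * L′ + N          ≤⟨ +-monoʳ-≤ (3 * L′) N≤3L ⟩
  3 * L′ + 3 * L      ≡⟨ *-distribˡ-+ 3 L′ L ⟨
  3 * (L′ + L)        ≤⟨ *-monoʳ-≤ 3 sum≤ ⟩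
  3 * suc N           ≡⟨ regroup N ⟩
  (2 * suc N + 1) + N ∎)
  where
  open ≤-Reasoning
  regroup : ∀ N → 3 * suc N ≡ (2 * suc N + 1) + N
  regroup = solve-∀

bm-continue : ∀ {u N} (S : BMState u N) → Generates u (BMState.current S) (suc N) → BMState u (suc N)
bm-continue {N = N} S still = record
  { current = current ; current-generates = still ; current-bound = bound-weaken (length current) N current-bound
  ; previous = previous ; breakpoint = breakpoint ; breakpoint<N = m<n⇒m<1+n breakpoint<N
  ; previous-breaks = previous-breaks ; lengths = lengths }
  where open BMState S

bm-repair-short : ∀ {u N k} (S : BMState u N) → BreaksAt u (BMState.current S) N →
  BMState.breakpoint S + suc k ≡ N → length (BMState.previous S) + suc k ≤ length (BMState.current S) →
  BMState u (suc N)
bm-repair-short {u} {N} {k} S breaks m+k+1≡N short with m≤n⇒∃[o]m+o≡n short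
... | k₂ , eq = record
  { current = update 0 current k₂ previous
  ; current-generates = generates-with-length u (update 0 current k₂ previous) length≡
      (update-generates 0 current k₂ previous breaks previous-breaks m+k+1≡N refl k₂-eq)
  ; current-bound = subst (λ L → 3 * L ≤ 2 * suc N + 1) (sym length≡)
      (bound-weaken (length current) N current-bound)
  ; previous = previous ; breakpoint = breakpoint ; breakpoint<N = m<n⇒m<1+n breakpoint<N
  ; previous-breaks = previous-breaks
  ; lengths = subst (λ L → L + length previous ≤ suc breakpoint) (sym length≡) lengths }
  where
  open BMState S
  k₂-eq : k₂ + (length previous + suc k) ≡ length current
  k₂-eq = trans (+-comm k₂ _) eq
  length≡ : length (update 0 current k₂ previous) ≡ length current
  length≡ = length-update 0 current k₂ previous refl k₂-eq

bm-repair-long : ∀ {u N k} → LengthAtLeastThird u →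
  (S : BMState u N) → BreaksAt u (BMState.current S) N →
  BMState.breakpoint S + suc k ≡ N → length (BMState.current S) ≤ length (BMState.previous S) + suc k →
  BMState u (suc N)
bm-repair-long {u} {N} {k} lower S breaks m+k+1≡N long with m≤n⇒∃[o]m+o≡n long
... | k₁ , eq = record
  { current = update k₁ current 0 previous
  ; current-generates = generates-with-length u (update k₁ current 0 previous) length≡
      (update-generates k₁ current 0 previous breaks previous-breaks m+k+1≡N k₁-eq refl)
  ; current-bound = subst (λ L → 3 * L ≤ 2 * suc N + 1) (sym length≡)
      (bound-new L′ (length current) N lengths′
        (lower N current (≤-trans (s≤s z≤n) breakpoint<N) current-generates))
  ; previous = current ; breakpoint = N ; breakpoint<N = ≤-refl ; previous-breaks = breaks
  ; lengths = subst (λ L → L + length current ≤ suc N) (sym length≡) lengths′ }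
  where
  open BMState S
  L′ : ℕ
  L′ = length previous + suc k
  k₁-eq : k₁ + length current ≡ L′
  k₁-eq = trans (+-comm k₁ _) eq
  length≡ : length (update k₁ current 0 previous) ≡ L′
  length≡ = length-update k₁ current 0 previous k₁-eq refl
  lengths′ : L′ + length current ≤ suc N
  lengths′ = begin
    (length previous + suc k) + length current ≡⟨ regroup (length previous) k (length current) ⟩
    (length current + length previous) + suc k ≤⟨ +-monoˡ-≤ (suc k) lengths ⟩
    suc breakpoint + suc k                     ≡⟨ cong suc m+k+1≡N ⟩
    suc N                                      ∎
    where
    open ≤-Reasoning
    regroup : ∀ P k L → (P + suc k) + L ≡ (L + P) + suc k
    regroup = solve-∀

bm-step : ∀ {u N} → LengthAtLeastThird u → BMState u N → BMState u (suc N)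
bm-step {u} {N} lower S with extend-or-break u (BMState.current S) N (BMState.current-generates S)
... | inj₁ still  = bm-continue S still
... | inj₂ breaks with m≤n⇒∃[o]m+o≡n (BMState.breakpoint<N S)
... | k , m+k+1≡N with length (BMState.previous S) + suc k ≤? length (BMState.current S)
... | yes short = bm-repair-short S breaks (trans (+-suc _ k) m+k+1≡N) short
... | no  long  = bm-repair-long lower S breaks (trans (+-suc _ k) m+k+1≡N) (<⇒≤ (≰⇒> long))

bm-state : ∀ u → u zero ≡ true → LengthAtLeastThird u → ∀ n → BMState u (suc n)
bm-state u u₀ lower zero    = bm-initial u u₀
bm-state u u₀ lower (suc n) = bm-step lower (bm-state u u₀ lower n)

predict-shift : ∀ t u n → predict t (λ k → u (suc k)) n ≡ predict t u (suc n)
predict-shift []      u n = refl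
predict-shift (a ∷ t) u n = cong ((a ∧ u (suc n)) xor_) (predict-shift t u (suc n))

linComb-tabulate : ∀ L c u n → linComb L c u n ≡ predict (tabulate c) u n
linComb-tabulate zero    c u n = refl
linComb-tabulate (suc L) c u n = cong ((c Fin.zero ∧ u n) xor_)
  (trans (linComb-tabulate L (λ i → c (Fin.suc i)) (λ k → u (suc k)) n)
         (predict-shift (tabulate (λ i → c (Fin.suc i))) u n))

recurrence-generates : ∀ {u N L} ((c , _) : HasRecurrence u N L) → Generates u (tabulate c) N
recurrence-generates {u} {L = L} (c , rec) = generates-with-length u (tabulate c) (length-tabulate c)
  λ n n+L<N → trans (rec n n+L<N) (linComb-tabulate L c u n)

generates-recurrence : ∀ {u N} t → Generates u t N → HasRecurrence u N (length t)
generates-recurrence {u} t gen = lookup t , λ n n+L<N → trans (gen n n+L<N)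
  (sym (trans (linComb-tabulate (length t) (lookup t) u n)
              (cong (λ t → predict t u n) (tabulate-lookup t))))

-- The Baum–Sweet sequence: the given recurrence of minimal length L has length ≥ N/3 by the
-- lower bound, and L is at most the length of the Berlekamp–Massey recurrence.
corollary3 : (N : ℕ) → 1 ≤ N → (L : ℕ) → IsLinearComplexity baumSweet N L →
    N ≤ 3 * L × 3 * L ≤ 2 * N + 1
corollary3 (suc n) 1≤N L (recurrence , minimal) = lower , upper
  where
  lower-bs : LengthAtLeastThird baumSweet
  lower-bs = lower-bound baumSweet refl (recursions⇒equation baumSweet baumSweet-recursions)
  lower : suc n ≤ 3 * L
  lower = subst (λ L → suc n ≤ 3 * L) (length-tabulate (proj₁ recurrence))
    (lower-bs (suc n) (tabulate (proj₁ recurrence)) 1≤N (recurrence-generates recurrence))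
  open BMState (bm-state baumSweet refl lower-bs n)
  L≤current : L ≤ length current
  L≤current with length current <? L
  ... | yes shorter    = ⊥-elim (minimal _ shorter (generates-recurrence current current-generates))
  ... | no not-shorter = ≮⇒≥ not-shorter
  upper : 3 * L ≤ 2 * suc n + 1
  upper = ≤-trans (*-monoʳ-≤ 3 L≤current) current-bound
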